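{- Let $A$ be a string of length $m$, $B$ a string of length $n$, and let $T$ be the lowest shortest path tree of $G_{AA,B}$ rooted at $(0,0)$. If the nodes of the top row, $(0,j)$ for $0\le j\le n$, are removed from $T$ (together with their incident tree edges), the remaining forest consists of at most two trees: one, $L$, containing $(1,0)$, and possibly a second one, $R$.
   Context: $AA$ denotes the concatenation of $A$ with itself, a string $X=X_1\cdots X_{2m}$. $G_{X,B}$ is the directed graph with nodes $(i,j)$, $0\le i\le 2m$, $0\le j\le n$ (first coordinate = row, increasing downward; second = column, increasing rightward), with unit-length edges $(i,j-1)\to(i,j)$ (horizontal), $(i-1,j)\to(i,j)$ (vertical), and $(i-1,j-1)\to(i,j)$ (diagonal) whenever $X_i=B_j$. A shortest path tree rooted at $(0,0)$ is a spanning tree in which the tree path from $(0,0)$ to every node is a shortest path. For two distinct paths $p,p'$ from $(0,0)$ to a node $v$, trace both backwards from $v$ and let $w$ be the first node at which they enter via different edges; $p$ is lower than $p'$ if $p$ enters $w$ via a horizontal edge while $p'$ enters via a diagonal or vertical edge, or $p$ enters via a diagonal edge while $p'$ enters via a vertical edge. A lowest shortest path tree rooted at $(0,0)$ is a shortest path tree such that for every node $v$ the tree path from $(0,0)$ to $v$ is lower than every other shortest path from $(0,0)$ to $v$. -}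

module Defs where

open import Data.Nat using (ℕ; zero; suc; _+_; _∸_; _≤_; _<_; _*_)
open import Data.Fin using (fromℕ<)
open import Data.Vec using (Vec; lookup)
open import Data.List using (List; []; _∷_; length)
open import Data.Product using (Σ; _×_; _,_)
open import Data.Empty using (⊥)
open import Relation.Binary.PropositionalEquality using (_≡_; _≢_)
open import Relation.Binary.Construct.Closure.Equivalence using (EqClosure)

Node : Set
Node = ℕ × ℕ

data Move : Set where
  H V D : Move

-- Preference order used by "lower": horizontal < diagonal < vertical.
data _<ₘ_ : Move → Move → Set where
  H<D : H <ₘ D
  H<V : H <ₘ V
  D<V : D <ₘ V

step : Move → Node → Node
step H (i , j) = i , j ∸ 1
step V (i , j) = i ∸ 1 , j
step D (i , j) = i ∸ 1 , j ∸ 1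

-- Match X B i j  :  X_i = B_j  (1-based indices), the condition for a
-- diagonal edge (i-1,j-1) → (i,j).
Match : {S : Set} {k n : ℕ} → Vec S k → Vec S n → ℕ → ℕ → Set
Match {k = k} {n} X B (suc i) (suc j) =
  Σ (i < k) λ p → Σ (j < n) λ q → lookup X (fromℕ< p) ≡ lookup B (fromℕ< q)
Match X B _ _ = ⊥

-- A path from (0,0) to (i,j) in G_{X,B}, described by the list of the kinds
-- of its edges read BACKWARDS from (i,j).  (Nodes stay inside the grid
-- automatically when (i,j) does, since edges only increase coordinates.)
data IsPath {S : Set} {k n : ℕ} (X : Vec S k) (B : Vec S n)
     : ℕ → ℕ → List Move → Set where
  nil : IsPath X B 0 0 []
  hor : ∀ {i j ms} → IsPath X B i j ms → IsPath X B i (suc j) (H ∷ ms)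
  ver : ∀ {i j ms} → IsPath X B i j ms → IsPath X B (suc i) j (V ∷ ms)
  dia : ∀ {i j ms} → Match X B (suc i) (suc j) → IsPath X B i j ms →
        IsPath X B (suc i) (suc j) (D ∷ ms)

IsShortest : {S : Set} {k n : ℕ} → Vec S k → Vec S n → ℕ → ℕ → List Move → Set
IsShortest X B i j ms =
  IsPath X B i j ms × (∀ ms′ → IsPath X B i j ms′ → length ms ≤ length ms′)

data Lower : List Move → List Move → Set where
  here  : ∀ {a b as bs} → a <ₘ b → Lower (a ∷ as) (b ∷ bs)
  there : ∀ {a as bs} → Lower as bs → Lower (a ∷ as) (a ∷ bs)

InGrid : ℕ → ℕ → Node → Set
InGrid rows n (i , j) = i ≤ rows × j ≤ n

-- A spanning tree rooted at (0,0) (an arborescence) is given by its parent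
-- map: par i j is the kind of the tree edge entering the non-root node (i,j);
-- its parent is step (par i j) (i , j).  The value at (0,0) is irrelevant.
ParentMap : Set
ParentMap = ℕ → ℕ → Move

-- Tree path from (0,0) to (i,j), backwards, obtained by following parents
-- (fuel i+j suffices for any valid tree since every edge decreases i+j).
treePathF : ParentMap → ℕ → ℕ → ℕ → List Move
treePathF par zero i j = []
treePathF par (suc f) zero zero = []
treePathF par (suc f) i j with step (par i j) (i , j)
... | (i′ , j′) = par i j ∷ treePathF par f i′ j′

treePath : ParentMap → ℕ → ℕ → List Move
treePath par i j = treePathF par (i + j) i j

IsLowestSPT : {S : Set} {k n : ℕ} → Vec S k → Vec S n → ParentMap → Set
IsLowestSPT {k = k} {n} X B par =
  ∀ i j → i ≤ k → j ≤ n →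
    IsShortest X B i j (treePath par i j) ×
    (∀ ms → IsShortest X B i j ms → ms ≢ treePath par i j →
       Lower (treePath par i j) ms)

InForest : ℕ → ℕ → Node → Set
InForest rows n (i , j) = 1 ≤ i × InGrid rows n (i , j)

ForestEdge : ℕ → ℕ → ParentMap → Node → Node → Set
ForestEdge rows n par u (i , j) =
  InForest rows n u × InForest rows n (i , j) × step (par i j) (i , j) ≡ u

SameTree : ℕ → ℕ → ParentMap → Node → Node → Set
SameTree rows n par = EqClosure (ForestEdge rows n par)

-- Deleting row 0 turns into roots exactly the nodes of row 1 whose tree edge
-- comes from row 0, i.e. is not horizontal, and every remaining node is joined
-- to such a root by following parents.  Column 0 gives the root (1,0).  Any
-- other root (1,b) either has a vertical tree edge, or a diagonal one with
-- another diagonal root (1,a), 0 < a < b, to its left; in both cases walking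
-- right along row 1 from (1,0) resp. (1,a) reaches (1,b) by an equally short
-- path ending in a horizontal edge, which is lower than the tree path.  So
-- there is at most one root besides (1,0).  Nothing about X = AA is used.

module Submission where

open import Defs
open import Data.Nat using (ℕ; zero; suc; _+_; _≤_; _<_; z≤n; s≤s)
open import Data.Nat.Properties
  using (≤-refl; ≤-trans; ≤-reflexive; n≤1+n; m<n⇒m<1+n; m<1+n⇒m<n∨m≡n;
         +-comm; <-cmp; m≤n⇒∃[o]m+o≡n)
open import Data.Vec using (Vec; _++_)
open import Data.List using (List; _∷_; length; replicate)
  renaming (_++_ to _++ˡ_)
open import Data.List.Properties using (length-replicate; length-++; ∷-injectiveˡ)
open import Data.Product using (Σ; _,_; _×_; proj₁; proj₂)
open import Data.Sum using (_⊎_; inj₁; inj₂; [_,_]′)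
open import Data.Empty using (⊥; ⊥-elim)
open import Relation.Nullary using (¬_; ¬?; Dec; yes; no; contradiction)
open import Relation.Binary.Definitions using (tri<; tri≈; tri>)
open import Relation.Binary.PropositionalEquality
open import Relation.Binary.Construct.Closure.Equivalence using (return)
open import Relation.Binary.Construct.Closure.ReflexiveTransitive using (ε; _◅◅_)

isH? : (mv : Move) → Dec (mv ≡ H)
isH? H = yes refl
isH? V = no λ ()
isH? D = no λ ()

nonH-nonV⇒D : ∀ {mv} → mv ≢ H → mv ≢ V → mv ≡ D
nonH-nonV⇒D {H} ≢H _  = contradiction refl ≢H
nonH-nonV⇒D {V} _  ≢V = contradiction refl ≢V
nonH-nonV⇒D {D} _  _  = refl

¬Lower-∷H : ∀ {a as bs} → a ≢ H → ¬ Lower (a ∷ as) (H ∷ bs)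
¬Lower-∷H {H} a≢H _ = a≢H refl
¬Lower-∷H {V} _ (here ())
¬Lower-∷H {D} _ (here ())

boundedSearch : {P : ℕ → Set} → (∀ j → Dec (P j)) → ∀ N →
                (Σ ℕ λ j → j < N × P j) ⊎ (∀ j → j < N → ¬ P j)
boundedSearch P? zero = inj₂ λ _ ()
boundedSearch {P} P? (suc N) with P? N | boundedSearch P? N
... | yes p | _                  = inj₁ (N , ≤-refl , p)
... | no _  | inj₁ (j , j<N , p) = inj₁ (j , m<n⇒m<1+n j<N , p)
... | no ¬p | inj₂ none          = inj₂ λ j j<1+N →
  [ none j , (λ j≡N → subst (λ x → ¬ P x) (sym j≡N) ¬p) ]′ (m<1+n⇒m<n∨m≡n j<1+N)

module _ {S : Set} {k n : ℕ} (X : Vec S k) (B : Vec S n) (par : ParentMap)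
         (lowest : IsLowestSPT X B par) where

  -- Chosen so that  treePath par (suc i) j  reduces to  par (suc i) j ∷ treeTail i j.
  treeTail : ℕ → ℕ → List Move
  treeTail i j = treePathF par (i + j) (proj₁ parent) (proj₂ parent)
    where parent = step (par (suc i) j) (suc i , j)

  treeEdge : ∀ {i j} → suc i ≤ k → j ≤ n → IsPath X B (suc i) j (par (suc i) j ∷ treeTail i j)
  treeEdge hi hj = proj₁ (proj₁ (lowest _ _ hi hj))

  horizontalRival⇒H : ∀ {i j alt} → suc i ≤ k → j ≤ n → IsPath X B (suc i) j (H ∷ alt) →
                      length alt ≤ length (treeTail i j) → par (suc i) j ≡ H
  horizontalRival⇒H {i} {j} {alt} hi hj rival alt≤tail with isH? (par (suc i) j)
  ... | yes isH = isH
  ... | no ≢H with lowest (suc i) j hi hj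
  ...   | (_ , minimal) , lowerThanShortest =
    contradiction (lowerThanShortest (H ∷ alt) (rival , shortest) (λ eq → ≢H (sym (∷-injectiveˡ eq))))
                  (¬Lower-∷H ≢H)
    where
    shortest : ∀ ms → IsPath X B (suc i) j ms → length (H ∷ alt) ≤ length ms
    shortest ms p = ≤-trans (s≤s alt≤tail) (minimal ms p)

  row0-length : ∀ {j ms} → IsPath X B 0 j ms → length ms ≡ j
  row0-length nil     = refl
  row0-length (hor p) = cong suc (row0-length p)

  rowOne-V-tailLength : ∀ {b} → 1 ≤ k → b ≤ n → par 1 b ≡ V → length (treeTail 0 b) ≡ b
  rowOne-V-tailLength {b} h1 hb e with par 1 b | treeEdge {0} {b} h1 hb
  rowOne-V-tailLength h1 hb refl | .V | ver q = row0-length q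

  rowOne-D-tailLength : ∀ {b} → 1 ≤ k → suc b ≤ n → par 1 (suc b) ≡ D → length (treeTail 0 (suc b)) ≡ b
  rowOne-D-tailLength {b} h1 hb e with par 1 (suc b) | treeEdge {0} {suc b} h1 hb
  rowOne-D-tailLength h1 hb refl | .D | dia _ q = row0-length q

  prependH : ∀ d {i j ms} → IsPath X B i j ms → IsPath X B i (d + j) (replicate d H ++ˡ ms)
  prependH zero    p = p
  prependH (suc d) p = hor (prependH d p)

  horizontalDetour : ∀ {i a ms} d → suc i ≤ k → suc (a + d) ≤ n → IsPath X B (suc i) a ms →
                     d + length ms ≤ length (treeTail i (suc (a + d))) →
                     par (suc i) (suc (a + d)) ≡ H
  horizontalDetour {i} {a} {ms} d hi hb p detour≤tail =
    horizontalRival⇒H hi hb (hor (subst (λ c → IsPath X B (suc i) c detour) (+-comm d a) (prependH d p)))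
                      (subst (_≤ length (treeTail i (suc (a + d)))) (sym detourLength) detour≤tail)
    where
    detour : List Move
    detour = replicate d H ++ˡ ms
    detourLength : length detour ≡ d + length ms
    detourLength = trans (length-++ (replicate d H)) (cong (_+ length ms) (length-replicate d))

  rowOne-notV : ∀ {b} → 1 ≤ k → suc b ≤ n → par 1 (suc b) ≢ V
  rowOne-notV {b} h1 hb e = contradiction (trans (sym e) viaOrigin) λ ()
    where
    viaOrigin : par 1 (suc b) ≡ H
    viaOrigin = horizontalDetour b h1 hb (ver nil)
                  (≤-reflexive (trans (+-comm b 1) (sym (rowOne-V-tailLength h1 hb e))))

  rowOne-nonH⇒D : ∀ {b} → 1 ≤ k → suc b ≤ n → par 1 (suc b) ≢ H → par 1 (suc b) ≡ D
  rowOne-nonH⇒D h1 hb ≢H = nonH-nonV⇒D ≢H (rowOne-notV h1 hb)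

  rowOne-uniqueRoot-< : ∀ {a b} → 1 ≤ k → a < b → suc b ≤ n →
                        par 1 (suc a) ≢ H → par 1 (suc b) ≢ H → ⊥
  rowOne-uniqueRoot-< {a} h1 a<b hb a≢H b≢H with m≤n⇒∃[o]m+o≡n a<b
  ... | d , refl = b≢H (horizontalDetour d h1 hb pathA (≤-reflexive detour≡tail))
    where
    ha : suc a ≤ n
    ha = ≤-trans a<b (≤-trans (n≤1+n _) hb)
    Da : par 1 (suc a) ≡ D
    Da = rowOne-nonH⇒D h1 ha a≢H
    pathA : IsPath X B 1 (suc a) (D ∷ treeTail 0 (suc a))
    pathA = subst (λ mv → IsPath X B 1 (suc a) (mv ∷ treeTail 0 (suc a))) Da (treeEdge h1 ha)
    detour≡tail : d + suc (length (treeTail 0 (suc a))) ≡ length (treeTail 0 (suc (suc a + d)))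
    detour≡tail = begin
      d + suc (length (treeTail 0 (suc a))) ≡⟨ cong (λ ℓ → d + suc ℓ) (rowOne-D-tailLength h1 ha Da) ⟩
      d + suc a                             ≡⟨ +-comm d (suc a) ⟩
      suc a + d                             ≡⟨ sym (rowOne-D-tailLength h1 hb (rowOne-nonH⇒D h1 hb b≢H)) ⟩
      length (treeTail 0 (suc (suc a + d))) ∎
      where open ≡-Reasoning

  rowOne-uniqueRoot : ∀ {a b} → 1 ≤ k → suc a ≤ n → suc b ≤ n →
                      par 1 (suc a) ≢ H → par 1 (suc b) ≢ H → a ≡ b
  rowOne-uniqueRoot {a} {b} h1 ha hb a≢H b≢H with <-cmp a b
  ... | tri< a<b _ _ = ⊥-elim (rowOne-uniqueRoot-< h1 a<b hb a≢H b≢H)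
  ... | tri≈ _ a≡b _ = a≡b
  ... | tri> _ _ b<a = ⊥-elim (rowOne-uniqueRoot-< h1 b<a ha b≢H a≢H)

  ReachesRowOneRoot : Node → Set
  ReachesRowOneRoot v = Σ ℕ λ r → r ≤ n × par 1 r ≢ H × SameTree k n par (1 , r) v

  atRowOneRoot : ∀ {j mv} → j ≤ n → par 1 j ≡ mv → mv ≢ H → ReachesRowOneRoot (1 , j)
  atRowOneRoot hj e mv≢H = _ , hj , (λ isH → mv≢H (trans (sym e) isH)) , ε

  inForest : ∀ {i j} → suc i ≤ k → j ≤ n → InForest k n (suc i , j)
  inForest hi hj = s≤s z≤n , hi , hj

  reachesRowOneRoot-viaParent : ∀ {i j mv} → suc i ≤ k → j ≤ n → par (suc i) j ≡ mv →
                                InForest k n (step mv (suc i , j)) →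
                                ReachesRowOneRoot (step mv (suc i , j)) → ReachesRowOneRoot (suc i , j)
  reachesRowOneRoot-viaParent {i} {j} hi hj e parentInForest (r , hr , r≢H , s) =
    r , hr , r≢H , s ◅◅ return (parentInForest , inForest hi hj , cong (λ mv → step mv (suc i , j)) e)

  reachesRowOneRoot : ∀ i j → suc i ≤ k → j ≤ n → ReachesRowOneRoot (suc i , j)
  reachesRowOneRoot i j hi hj with par (suc i) j in e | treeEdge hi hj
  ... | H | hor {j = j′} _ =
    reachesRowOneRoot-viaParent hi hj e (inForest hi hj′) (reachesRowOneRoot i j′ hi hj′)
    where hj′ = ≤-trans (n≤1+n j′) hj
  reachesRowOneRoot zero j hi hj | V | _ = atRowOneRoot hj e λ ()
  reachesRowOneRoot zero j hi hj | D | _ = atRowOneRoot hj e λ ()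
  reachesRowOneRoot (suc i) j hi hj | V | _ =
    reachesRowOneRoot-viaParent hi hj e (inForest hi′ hj) (reachesRowOneRoot i j hi′ hj)
    where hi′ = ≤-trans (n≤1+n (suc i)) hi
  reachesRowOneRoot (suc i) .(suc j′) hi hj | D | dia {j = j′} _ _ =
    reachesRowOneRoot-viaParent hi hj e (inForest hi′ hj′) (reachesRowOneRoot i j′ hi′ hj′)
    where hi′ = ≤-trans (n≤1+n (suc i)) hi
          hj′ = ≤-trans (n≤1+n j′) hj

  forest-atMostTwoTrees : Σ Node λ r → ∀ v → InForest k n v →
                          SameTree k n par (1 , 0) v ⊎ SameTree k n par r v
  forest-atMostTwoTrees = (1 , secondRoot) , component
    where
    search : (Σ ℕ λ j → j < n × par 1 (suc j) ≢ H) ⊎ (∀ j → j < n → ¬ par 1 (suc j) ≢ H)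
    search = boundedSearch (λ j → ¬? (isH? (par 1 (suc j)))) n

    secondRoot : ℕ
    secondRoot with search
    ... | inj₁ (j , _) = suc j
    ... | inj₂ _       = 0

    classify : ∀ {v} → 1 ≤ k → ReachesRowOneRoot v →
               SameTree k n par (1 , 0) v ⊎ SameTree k n par (1 , secondRoot) v
    classify h1 (zero , _ , _ , s) = inj₁ s
    classify h1 (suc r , hr , r≢H , s) with search
    ... | inj₁ (j , j<n , j≢H) rewrite rowOne-uniqueRoot h1 hr j<n r≢H j≢H = inj₂ s
    ... | inj₂ none            = contradiction r≢H (none r hr)

    component : ∀ v → InForest k n v →
                SameTree k n par (1 , 0) v ⊎ SameTree k n par (1 , secondRoot) v
    component (suc i , j) (_ , hi , hj) = classify (≤-trans (s≤s z≤n) hi) (reachesRowOneRoot i j hi hj)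

lemma4 : {S : Set} (m n : ℕ) (A : Vec S m) (B : Vec S n) (par : ParentMap) →
         IsLowestSPT (A ++ A) B par →
         Σ Node λ r → ∀ v → InForest (m + m) n v →
           SameTree (m + m) n par (1 , 0) v ⊎ SameTree (m + m) n par r v
lemma4 m n A B par lowest = forest-atMostTwoTrees (A ++ A) B par lowest
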